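{- Let $k\geq 1$ be an integer, let $G=(V,E)$ be a $k$-tree, and let $\Delta\subseteq V$ be a $(k+1)$-clique in $G$. Suppose that deleting the vertices of $\Delta$ from $G$ leaves exactly $m$ connected components, i.e. $\Delta$ separates $G$ into $m$ connected components. Then $\Delta$ has at most $m$ neighbors.
   Context: $k$-trees are defined recursively: a $k$-tree with exactly $k$ vertices is a $k$-clique; for $n>k$, a $k$-tree $G=(V,E)$ with $n$ vertices is obtained from a $k$-tree $H=(U,F)$ with $n-1$ vertices by adding a new vertex $v\notin U$ and joining it to every vertex of some $k$-clique $C$ of $H$, i.e. $V=U\cup\{v\}$ and $E=F\cup\{(v,u):u\in C\}$. For a $(k+1)$-clique $\Delta$ of a $k$-tree $G$, a neighbor of $\Delta$ is a $(k+1)$-clique $\Delta'$ of $G$ with $|\Delta\cap\Delta'|=k$. A vertex set $S$ separates $G$ into disconnected components if $S$ is disjoint from these components and every path between vertices of two different components contains a vertex of $S$; here the components are the connected components of $G-S$. -}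

module Defs where

open import Level using (0ℓ)
open import Data.Nat using (ℕ; zero; suc)
open import Data.Fin using (Fin; punchIn)
open import Data.Fin.Subset using (Subset; _∈_; _∉_; _∩_; ∣_∣)
open import Data.Product using (Σ; ∃; _×_)
open import Relation.Binary.PropositionalEquality using (_≡_; _≢_)
open import Relation.Nullary using (¬_)
open import Function.Bundles using (_⇔_)

Graph : ℕ → Set₁
Graph n = Fin n → Fin n → Set

IsClique : ∀ {n} → Graph n → Subset n → Set
IsClique G S = ∀ i j → i ∈ S → j ∈ S → i ≢ j → G i j

IsKClique : ∀ {n} → ℕ → Graph n → Subset n → Set
IsKClique k G S = IsClique G S × ∣ S ∣ ≡ k

deleteVertex : ∀ {n} → Graph (suc n) → Fin (suc n) → Graph n
deleteVertex G v i j = G (punchIn v i) (punchIn v j)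

data KTree (k : ℕ) : (n : ℕ) → Graph n → Set₁ where
  base : (G : Graph k) → (∀ i j → G i j ⇔ (i ≢ j)) → KTree k k G
  step : ∀ {n} (G : Graph (suc n)) (v : Fin (suc n)) (C : Subset n) →
         KTree k n (deleteVertex G v) →
         IsKClique k (deleteVertex G v) C →
         (∀ i → G v (punchIn v i) ⇔ (i ∈ C)) →
         (∀ i → G (punchIn v i) v ⇔ (i ∈ C)) →
         ¬ G v v →
         KTree k (suc n) G

data PathAvoiding {n} (G : Graph n) (S : Subset n) : Fin n → Fin n → Set where
  here  : ∀ {i} → i ∉ S → PathAvoiding G S i i
  there : ∀ {i j l} → i ∉ S → G i j → PathAvoiding G S j l → PathAvoiding G S i l

-- G - S has exactly m connected components: there is a labelling of the vertices
-- outside S by Fin m such that two vertices get the same label iff they are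
-- connected in G - S, and every label is used.
HasComponents : ∀ {n} → Graph n → Subset n → ℕ → Set
HasComponents {n} G S m =
  Σ ((i : Fin n) → i ∉ S → Fin m) λ c →
    (∀ i j (p : i ∉ S) (q : j ∉ S) → (c i p ≡ c j q) ⇔ PathAvoiding G S i j) ×
    (∀ (x : Fin m) → ∃ λ i → Σ (i ∉ S) λ p → c i p ≡ x)

IsNeighbor : ∀ {n} → ℕ → Graph n → Subset n → Subset n → Set
IsNeighbor k G Δ Δ' = IsKClique (suc k) G Δ' × ∣ Δ ∩ Δ' ∣ ≡ k

-- Call a vertex outside a clique C and adjacent to all of C an apex of C. The key fact is that
-- in a k-tree two apexes of a k-clique C joined by a walk avoiding C coincide. It is proved along
-- the construction of the k-tree, looking at the last added vertex v, whose neighbourhood is a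
-- k-clique C′: if v ∈ C, every apex of C lies in C′ minus C, which has one element; if v is an
-- end of the walk, then C′ ⊆ C and the walk cannot leave v; otherwise each visit of the walk to
-- v enters and leaves through the clique C′, so it can be short-cut, and induction applies to G − v.
--
-- A neighbour Δ′ of Δ is Δ ∩ Δ′ plus one vertex y ∉ Δ, an apex of the k-clique Δ ∩ Δ′. If the
-- new vertices y₁, y₂ of two neighbours lie in one component of G − Δ, then Δ ∩ Δ₁ ⊆ Δ₂, since a
-- vertex of Δ ∩ Δ₁ outside Δ₂ would be an apex of Δ ∩ Δ₂ joined to y₂ through y₁. Hence
-- Δ ∩ Δ₁ = Δ ∩ Δ₂, then y₁ = y₂ and Δ₁ = Δ₂: sending Δ′ to the component of y is injective.

{-# OPTIONS --safe #-}
module Submission where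

open import Defs
open import Data.Nat using (ℕ; suc; _≤_)
open import Data.Fin.Subset using (Subset)
open import Data.List using (List; length)
open import Data.List.Relation.Unary.All using (All)
open import Data.List.Relation.Unary.Unique.Propositional using (Unique)

open import Data.Nat using (_<_; s≤s)
open import Data.Nat.Properties using (≤-reflexive; ≤-trans; <⇒≱)
open import Data.Fin using (Fin; zero; suc; punchIn; punchOut; _≟_)
open import Data.Fin.Properties using (punchIn-punchOut; punchInᵢ≢i; punchIn-injective; any?; injective⇒≤)
open import Data.Fin.Subset using (_∈_; _∉_; _⊆_; _⊂_; _∩_; _∪_; _-_; ⁅_⁆; ∣_∣; inside; outside)
open import Data.Fin.Subset.Properties
  using (_∈?_; ∈⊤; ∣p∣≡n⇒p≡⊤; p⊂q⇒∣p∣<∣q∣; p⊆q⇒∣p∣≤∣q∣; x∈p⇒∣p-x∣<∣p∣; x∈p∧x≢y⇒x∈p-y;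
         p∩q⊆p; p∩q⊆q; x∈p∩q⁺; x∈p∪q⁺; x∈p∪q⁻; x∈⁅x⁆; x∈⁅y⁆⇒x≡y; ⊆-antisym)
open import Data.Vec.Base using (Vec; lookup; removeAt; _∷_; here; there)
open import Data.Vec.Properties using ([]=⇒lookup; lookup⇒[]=)
import Data.List as List
import Data.List.Relation.Unary.All as All
open import Data.List.Relation.Unary.AllPairs using (_∷_)
open import Data.List.Membership.Propositional.Properties using (∈-lookup)
open import Data.Product using (∃; _×_; _,_; proj₁; proj₂)
open import Data.Sum using (inj₁; inj₂)
open import Function using (_∘_)
open import Function.Bundles using (Equivalence)
open import Function.Definitions using (Injective)
open import Relation.Nullary using (¬_; yes; no; contradiction)
open import Relation.Nullary.Decidable using (_×-dec_; ¬?; decidable-stable)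
open import Relation.Binary.PropositionalEquality using (_≡_; refl; sym; trans; cong; cong₂; subst; module ≡-Reasoning)

open Equivalence using (to)

private
  variable
    k n : ℕ

lookup-injective : ∀ {a} {A : Set a} {xs : List A} → Unique xs →
                   ∀ i j → List.lookup xs i ≡ List.lookup xs j → i ≡ j
lookup-injective (_ ∷ _)      zero    zero    _  = refl
lookup-injective (x∉xs ∷ _)   zero    (suc j) eq = contradiction eq (All.lookup x∉xs (∈-lookup j))
lookup-injective (x∉xs ∷ _)   (suc i) zero    eq = contradiction (sym eq) (All.lookup x∉xs (∈-lookup i))
lookup-injective (_ ∷ unique) (suc i) (suc j) eq = cong suc (lookup-injective unique i j eq)

data PunchInView {n} (v : Fin (suc n)) : Fin (suc n) → Set where
  pivot   : PunchInView v v
  punched : (i : Fin n) → PunchInView v (punchIn v i)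

punchInView : ∀ {n} (v x : Fin (suc n)) → PunchInView v x
punchInView v x with v ≟ x
... | yes refl = pivot
... | no v≢x   = subst (PunchInView v) (punchIn-punchOut v≢x) (punched (punchOut v≢x))

p⊆q∧∣q∣≤∣p∣⇒q⊆p : {p q : Subset n} → p ⊆ q → ∣ q ∣ ≤ ∣ p ∣ → q ⊆ p
p⊆q∧∣q∣≤∣p∣⇒q⊆p {p = p} {q = q} p⊆q ∣q∣≤∣p∣ {x} x∈q with x ∈? p
... | yes x∈p = x∈p
... | no  x∉p = contradiction ∣q∣≤∣p∣ (<⇒≱ (p⊂q⇒∣p∣<∣q∣ (p⊆q , x , x∈q , x∉p)))

p⊆q∧∣q∣≤1+∣p∣⇒q∖p-unique : {p q : Subset n} → p ⊆ q → ∣ q ∣ ≤ suc ∣ p ∣ →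
                           ∀ {x y} → x ∈ q → x ∉ p → y ∈ q → y ∉ p → x ≡ y
p⊆q∧∣q∣≤1+∣p∣⇒q∖p-unique {p = p} {q = q} p⊆q ∣q∣≤1+∣p∣ {x} {y} x∈q x∉p y∈q y∉p with x ≟ y
... | yes x≡y = x≡y
... | no  x≢y = contradiction ∣q∣≤1+∣p∣ (<⇒≱ (≤-trans (s≤s (p⊂q⇒∣p∣<∣q∣ p⊂q-y)) (x∈p⇒∣p-x∣<∣p∣ y∈q)))
  where
  p⊂q-y : p ⊂ q - y
  p⊂q-y = (λ z∈p → x∈p∧x≢y⇒x∈p-y (p⊆q z∈p) (λ { refl → y∉p z∈p }))
        , x , x∈p∧x≢y⇒x∈p-y x∈q x≢y , x∉p

∣p∩q∣<∣q∣⇒∃∈q∉p : {p q : Subset n} → ∣ p ∩ q ∣ < ∣ q ∣ → ∃ λ x → x ∈ q × x ∉ p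
∣p∩q∣<∣q∣⇒∃∈q∉p {p = p} {q = q} ∣p∩q∣<∣q∣ with any? (λ x → (x ∈? q) ×-dec ¬? (x ∈? p))
... | yes found = found
... | no  none  = contradiction (p⊆q⇒∣p∣≤∣q∣ q⊆p∩q) (<⇒≱ ∣p∩q∣<∣q∣)
  where
  q⊆p∩q : q ⊆ p ∩ q
  q⊆p∩q {x} x∈q = x∈p∩q⁺ (decidable-stable (x ∈? p) (λ x∉p → none (x , x∈q , x∉p)) , x∈q)

∣q∣≡1+∣p∩q∣⇒q≡p∩q∪⁅y⁆ : {p q : Subset n} → ∣ q ∣ ≡ suc ∣ p ∩ q ∣ →
                         ∀ {y} → y ∈ q → y ∉ p → q ≡ p ∩ q ∪ ⁅ y ⁆
∣q∣≡1+∣p∩q∣⇒q≡p∩q∪⁅y⁆ {p = p} {q = q} ∣q∣≡1+∣p∩q∣ {y} y∈q y∉p = ⊆-antisym q⊆ ⊆q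
  where
  q⊆ : q ⊆ p ∩ q ∪ ⁅ y ⁆
  q⊆ {x} x∈q with x ∈? p
  ... | yes x∈p = x∈p∪q⁺ (inj₁ (x∈p∩q⁺ (x∈p , x∈q)))
  ... | no  x∉p = x∈p∪q⁺ (inj₂ (subst (_∈ ⁅ y ⁆) (sym x≡y) (x∈⁅x⁆ y)))
    where
    x≡y : x ≡ y
    x≡y = p⊆q∧∣q∣≤1+∣p∣⇒q∖p-unique (p∩q⊆q p q) (≤-reflexive ∣q∣≡1+∣p∩q∣)
            x∈q (x∉p ∘ p∩q⊆p p q) y∈q (y∉p ∘ p∩q⊆p p q)
  ⊆q : p ∩ q ∪ ⁅ y ⁆ ⊆ q
  ⊆q x∈ with x∈p∪q⁻ (p ∩ q) ⁅ y ⁆ x∈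
  ... | inj₁ x∈p∩q = p∩q⊆q p q x∈p∩q
  ... | inj₂ x∈⁅y⁆ = subst (_∈ q) (sym (x∈⁅y⁆⇒x≡y y x∈⁅y⁆)) y∈q

lookup-removeAt : ∀ {a} {A : Set a} (xs : Vec A (suc n)) v i →
                  lookup (removeAt xs v) i ≡ lookup xs (punchIn v i)
lookup-removeAt (x ∷ xs)     zero    i       = refl
lookup-removeAt (x ∷ y ∷ xs) (suc v) zero    = refl
lookup-removeAt (x ∷ y ∷ xs) (suc v) (suc i) = lookup-removeAt (y ∷ xs) v i

∈-removeAt⁻ : ∀ {p : Subset (suc n)} {v i} → i ∈ removeAt p v → punchIn v i ∈ p
∈-removeAt⁻ {p = p} {v} {i} i∈ =
  lookup⇒[]= (punchIn v i) p (trans (sym (lookup-removeAt p v i)) ([]=⇒lookup i∈))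

∣removeAt∣-∈ : ∀ (p : Subset (suc n)) {v} → v ∈ p → ∣ p ∣ ≡ suc ∣ removeAt p v ∣
∣removeAt∣-∈ (inside ∷ p)      {zero}  _          = refl
∣removeAt∣-∈ (inside ∷ b ∷ p)  {suc v} (there v∈) = cong suc (∣removeAt∣-∈ (b ∷ p) v∈)
∣removeAt∣-∈ (outside ∷ b ∷ p) {suc v} (there v∈) = ∣removeAt∣-∈ (b ∷ p) v∈

∣removeAt∣-∉ : ∀ (p : Subset (suc n)) {v} → v ∉ p → ∣ p ∣ ≡ ∣ removeAt p v ∣
∣removeAt∣-∉ (inside ∷ p)      {zero}  v∉ = contradiction here v∉
∣removeAt∣-∉ (outside ∷ p)     {zero}  v∉ = refl
∣removeAt∣-∉ (inside ∷ b ∷ p)  {suc v} v∉ = cong suc (∣removeAt∣-∉ (b ∷ p) (v∉ ∘ there))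
∣removeAt∣-∉ (outside ∷ b ∷ p) {suc v} v∉ = ∣removeAt∣-∉ (b ∷ p) (v∉ ∘ there)

IsApex : Graph n → Subset n → Fin n → Set
IsApex G C y = y ∉ C × (∀ c → c ∈ C → G y c)

module _ {G : Graph n} where

  ⊆-clique : ∀ {F Q} → IsClique G Q → F ⊆ Q → IsClique G F
  ⊆-clique Q-clique F⊆Q i j i∈F j∈F = Q-clique i j (F⊆Q i∈F) (F⊆Q j∈F)

  clique-apex : ∀ {F Q y} → IsClique G Q → F ⊆ Q → y ∈ Q → y ∉ F → IsApex G F y
  clique-apex Q-clique F⊆Q y∈Q y∉F =
    y∉F , λ c c∈F → Q-clique _ c y∈Q (F⊆Q c∈F) (λ { refl → y∉F c∈F })

  PathAvoiding-antimono : ∀ {S S′ a b} → S′ ⊆ S → PathAvoiding G S a b → PathAvoiding G S′ a b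
  PathAvoiding-antimono S′⊆S (here a∉S)        = here (a∉S ∘ S′⊆S)
  PathAvoiding-antimono S′⊆S (there a∉S a→j p) = there (a∉S ∘ S′⊆S) a→j (PathAvoiding-antimono S′⊆S p)

  prepend-within-clique : ∀ {C S a z b} → IsClique G C → a ∉ S → a ∈ C → z ∈ C →
                          PathAvoiding G S z b → PathAvoiding G S a b
  prepend-within-clique {a = a} {z} C-clique a∉S a∈C z∈C z⇝b with a ≟ z
  ... | yes refl = z⇝b
  ... | no  a≢z  = there a∉S (C-clique a z a∈C z∈C a≢z) z⇝b

  out-neighbours⊆S⇒path-trivial : ∀ {S a b} → (∀ x → G a x → x ∈ S) → PathAvoiding G S a b → a ≡ b
  out-neighbours⊆S⇒path-trivial a→S (here _)                     = refl
  out-neighbours⊆S⇒path-trivial a→S (there _ a→j (here j∉S))     = contradiction (a→S _ a→j) j∉S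
  out-neighbours⊆S⇒path-trivial a→S (there _ a→j (there j∉S _ _)) = contradiction (a→S _ a→j) j∉S

  in-neighbours⊆S⇒path-trivial : ∀ {S a b} → (∀ x → G x b → x ∈ S) → PathAvoiding G S a b → a ≡ b
  in-neighbours⊆S⇒path-trivial S→b (here _) = refl
  in-neighbours⊆S⇒path-trivial S→b (there a∉S a→j j⇝b) with in-neighbours⊆S⇒path-trivial S→b j⇝b
  ... | refl = contradiction (S→b _ a→j) a∉S

module _ {G : Graph (suc n)} {v : Fin (suc n)} where

  removeAt-clique : ∀ {S} → IsClique G S → IsClique (deleteVertex G v) (removeAt S v)
  removeAt-clique S-clique i j i∈ j∈ i≢j =
    S-clique _ _ (∈-removeAt⁻ i∈) (∈-removeAt⁻ j∈) (i≢j ∘ punchIn-injective v i j)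

  removeAt-apex : ∀ {S y} → IsApex G S (punchIn v y) → IsApex (deleteVertex G v) (removeAt S v) y
  removeAt-apex (y∉S , y→S) = y∉S ∘ ∈-removeAt⁻ , λ c c∈ → y→S _ (∈-removeAt⁻ c∈)

module Extension {G : Graph (suc n)} {v : Fin (suc n)} {C′ : Subset n}
                 (C′-kClique : IsKClique k (deleteVertex G v) C′)
                 (v→C′ : ∀ i → G v (punchIn v i) → i ∈ C′)
                 (C′→v : ∀ i → G (punchIn v i) v → i ∈ C′)
                 (¬v→v : ¬ G v v) where

  H : Graph n
  H = deleteVertex G v

  shortcut : ∀ {S a b′ b} → PathAvoiding G S (punchIn v a) b′ → b′ ≡ punchIn v b →
             PathAvoiding H (removeAt S v) a b
  shortcut (here a∉S) b′≡ =
    subst (PathAvoiding H _ _) (punchIn-injective v _ _ b′≡) (here (a∉S ∘ ∈-removeAt⁻))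
  shortcut (there {j = j} a∉S a→j j⇝b) b′≡ with punchInView v j
  ... | punched j₀ = there (a∉S ∘ ∈-removeAt⁻) a→j (shortcut j⇝b b′≡)
  shortcut (there a∉S a→v (here _)) b′≡ | pivot = contradiction (sym b′≡) (punchInᵢ≢i v _)
  shortcut (there a∉S a→v (there {j = z} _ v→z z⇝b)) b′≡ | pivot with punchInView v z
  ... | pivot      = contradiction v→z ¬v→v
  ... | punched z₀ = prepend-within-clique (proj₁ C′-kClique) (a∉S ∘ ∈-removeAt⁻)
                       (C′→v _ a→v) (v→C′ z₀ v→z) (shortcut z⇝b b′≡)

  C′⊆S∖v⇒out-neighbours⊆S : ∀ {S} → C′ ⊆ removeAt S v → ∀ x → G v x → x ∈ S
  C′⊆S∖v⇒out-neighbours⊆S C′⊆S∖v x v→x with punchInView v x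
  ... | pivot      = contradiction v→x ¬v→v
  ... | punched x₀ = ∈-removeAt⁻ (C′⊆S∖v (v→C′ x₀ v→x))

  C′⊆S∖v⇒in-neighbours⊆S : ∀ {S} → C′ ⊆ removeAt S v → ∀ x → G x v → x ∈ S
  C′⊆S∖v⇒in-neighbours⊆S C′⊆S∖v x x→v with punchInView v x
  ... | pivot      = contradiction x→v ¬v→v
  ... | punched x₀ = ∈-removeAt⁻ (C′⊆S∖v (C′→v x₀ x→v))

  apex-pivot⇒C′⊆C∖v : ∀ {C} → ∣ C ∣ ≡ k → IsApex G C v → C′ ⊆ removeAt C v
  apex-pivot⇒C′⊆C∖v {C} ∣C∣≡k (v∉C , v→C) =
    p⊆q∧∣q∣≤∣p∣⇒q⊆p (λ i∈ → v→C′ _ (v→C _ (∈-removeAt⁻ i∈)))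
      (≤-reflexive (trans (proj₂ C′-kClique) (trans (sym ∣C∣≡k) (∣removeAt∣-∉ C v∉C))))

  pivot∈C⇒apex-unique : ∀ {C y y′} → IsKClique k G C → v ∈ C →
                        IsApex G C (punchIn v y) → IsApex G C (punchIn v y′) → y ≡ y′
  pivot∈C⇒apex-unique {C} (C-clique , ∣C∣≡k) v∈C (y∉C , y→C) (y′∉C , y′→C) =
    p⊆q∧∣q∣≤1+∣p∣⇒q∖p-unique C∖v⊆C′
      (≤-reflexive (trans (proj₂ C′-kClique) (trans (sym ∣C∣≡k) (∣removeAt∣-∈ C v∈C))))
      (C′→v _ (y→C v v∈C)) (y∉C ∘ ∈-removeAt⁻) (C′→v _ (y′→C v v∈C)) (y′∉C ∘ ∈-removeAt⁻)
    where
    C∖v⊆C′ : removeAt C v ⊆ C′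
    C∖v⊆C′ {i} i∈ = v→C′ i (C-clique v _ v∈C (∈-removeAt⁻ i∈) (punchInᵢ≢i v i ∘ sym))

  apex-unique-step : (∀ {C y y′} → IsKClique k H C → IsApex H C y → IsApex H C y′ →
                        PathAvoiding H C y y′ → y ≡ y′) →
                     ∀ {C y y′} → IsKClique k G C → IsApex G C y → IsApex G C y′ →
                     PathAvoiding G C y y′ → y ≡ y′
  apex-unique-step apex-unique-H {C} {y} {y′} C-kClique@(C-clique , ∣C∣≡k) y-apex y′-apex y⇝y′
    with v ∈? C | punchInView v y | punchInView v y′
  ... | yes v∈C | pivot      | _           = contradiction v∈C (proj₁ y-apex)
  ... | yes v∈C | _          | pivot       = contradiction v∈C (proj₁ y′-apex)
  ... | yes v∈C | punched y₀ | punched y₀′ =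
    cong (punchIn v) (pivot∈C⇒apex-unique C-kClique v∈C y-apex y′-apex)
  ... | no  v∉C | pivot      | _           =
    out-neighbours⊆S⇒path-trivial (C′⊆S∖v⇒out-neighbours⊆S (apex-pivot⇒C′⊆C∖v ∣C∣≡k y-apex)) y⇝y′
  ... | no  v∉C | _          | pivot       =
    in-neighbours⊆S⇒path-trivial (C′⊆S∖v⇒in-neighbours⊆S (apex-pivot⇒C′⊆C∖v ∣C∣≡k y′-apex)) y⇝y′
  ... | no  v∉C | punched y₀ | punched y₀′ =
    cong (punchIn v) (apex-unique-H (removeAt-clique C-clique , trans (sym (∣removeAt∣-∉ C v∉C)) ∣C∣≡k)
                        (removeAt-apex {G = G} y-apex) (removeAt-apex {G = G} y′-apex) (shortcut y⇝y′ refl))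

apex-unique : ∀ {G : Graph n} → KTree k n G →
              ∀ {C y y′} → IsKClique k G C → IsApex G C y → IsApex G C y′ →
              PathAvoiding G C y y′ → y ≡ y′
apex-unique (base _ _) (_ , ∣C∣≡k) (y∉C , _) _ _ =
  contradiction (subst (_ ∈_) (sym (∣p∣≡n⇒p≡⊤ ∣C∣≡k)) ∈⊤) y∉C
apex-unique (step G v C′ T C′-kClique v→C′ C′→v ¬v→v) =
  Extension.apex-unique-step C′-kClique (λ i → to (v→C′ i)) (λ i → to (C′→v i)) ¬v→v (apex-unique T)

module _ {G : Graph n} {Δ : Subset n} where

  neighbour-∩-kClique : IsClique G Δ → ∀ {Δ′} → IsNeighbor k G Δ Δ′ → IsKClique k G (Δ ∩ Δ′)
  neighbour-∩-kClique Δ-clique {Δ′ = Δ′} (_ , ∣Δ∩Δ′∣≡k) = ⊆-clique Δ-clique (p∩q⊆p Δ Δ′) , ∣Δ∩Δ′∣≡k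

  neighbour-new-apex : ∀ {Δ′ y} → IsNeighbor k G Δ Δ′ → y ∈ Δ′ → y ∉ Δ → IsApex G (Δ ∩ Δ′) y
  neighbour-new-apex {Δ′ = Δ′} ((Δ′-clique , _) , _) y∈Δ′ y∉Δ =
    clique-apex Δ′-clique (p∩q⊆q Δ Δ′) y∈Δ′ (y∉Δ ∘ p∩q⊆p Δ Δ′)

  neighbour-new-vertex : ∀ {Δ′} → IsNeighbor k G Δ Δ′ → ∃ λ y → y ∈ Δ′ × y ∉ Δ
  neighbour-new-vertex ((_ , ∣Δ′∣≡1+k) , ∣Δ∩Δ′∣≡k) =
    ∣p∩q∣<∣q∣⇒∃∈q∉p (≤-reflexive (trans (cong suc ∣Δ∩Δ′∣≡k) (sym ∣Δ′∣≡1+k)))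

  neighbour-split : ∀ {Δ′ y} → IsNeighbor k G Δ Δ′ → y ∈ Δ′ → y ∉ Δ → Δ′ ≡ Δ ∩ Δ′ ∪ ⁅ y ⁆
  neighbour-split ((_ , ∣Δ′∣≡1+k) , ∣Δ∩Δ′∣≡k) =
    ∣q∣≡1+∣p∩q∣⇒q≡p∩q∪⁅y⁆ (trans ∣Δ′∣≡1+k (cong suc (sym ∣Δ∩Δ′∣≡k)))

  module _ (T : KTree k n G) (Δ-clique : IsClique G Δ) {Δ₁ Δ₂ y₁ y₂}
           (N₁ : IsNeighbor k G Δ Δ₁) (N₂ : IsNeighbor k G Δ Δ₂)
           (y₁∈Δ₁ : y₁ ∈ Δ₁) (y₁∉Δ : y₁ ∉ Δ) (y₂∈Δ₂ : y₂ ∈ Δ₂) (y₂∉Δ : y₂ ∉ Δ)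
           (y₁⇝y₂ : PathAvoiding G Δ y₁ y₂) where

    connected-neighbours-∩⊆ : Δ ∩ Δ₁ ⊆ Δ₂
    connected-neighbours-∩⊆ {a} a∈Δ∩Δ₁ with a ∈? Δ₂
    ... | yes a∈Δ₂ = a∈Δ₂
    ... | no  a∉Δ₂ = contradiction (subst (_∈ Δ) a≡y₂ a∈Δ) y₂∉Δ
      where
      a∈Δ : a ∈ Δ
      a∈Δ = p∩q⊆p Δ Δ₁ a∈Δ∩Δ₁
      a⇝y₂ : PathAvoiding G (Δ ∩ Δ₂) a y₂
      a⇝y₂ = there (a∉Δ₂ ∘ p∩q⊆q Δ Δ₂)
                   (proj₁ (proj₁ N₁) a y₁ (p∩q⊆q Δ Δ₁ a∈Δ∩Δ₁) y₁∈Δ₁ (λ { refl → y₁∉Δ a∈Δ }))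
                   (PathAvoiding-antimono (p∩q⊆p Δ Δ₂) y₁⇝y₂)
      a≡y₂ : a ≡ y₂
      a≡y₂ = apex-unique T (neighbour-∩-kClique Δ-clique N₂)
               (clique-apex Δ-clique (p∩q⊆p Δ Δ₂) a∈Δ (a∉Δ₂ ∘ p∩q⊆q Δ Δ₂))
               (neighbour-new-apex N₂ y₂∈Δ₂ y₂∉Δ) a⇝y₂

    connected-neighbours-≡ : Δ₁ ≡ Δ₂
    connected-neighbours-≡ = begin
      Δ₁               ≡⟨ neighbour-split N₁ y₁∈Δ₁ y₁∉Δ ⟩
      Δ ∩ Δ₁ ∪ ⁅ y₁ ⁆  ≡⟨ cong₂ (λ F y → F ∪ ⁅ y ⁆) same-∩ y₁≡y₂ ⟩
      Δ ∩ Δ₂ ∪ ⁅ y₂ ⁆  ≡⟨ sym (neighbour-split N₂ y₂∈Δ₂ y₂∉Δ) ⟩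
      Δ₂               ∎
      where
      open ≡-Reasoning
      ∩⊆∩ : Δ ∩ Δ₁ ⊆ Δ ∩ Δ₂
      ∩⊆∩ a∈ = x∈p∩q⁺ (p∩q⊆p Δ Δ₁ a∈ , connected-neighbours-∩⊆ a∈)
      same-∩ : Δ ∩ Δ₁ ≡ Δ ∩ Δ₂
      same-∩ = ⊆-antisym ∩⊆∩ (p⊆q∧∣q∣≤∣p∣⇒q⊆p ∩⊆∩ (≤-reflexive (trans (proj₂ N₂) (sym (proj₂ N₁)))))
      y₁≡y₂ : y₁ ≡ y₂
      y₁≡y₂ = apex-unique T (neighbour-∩-kClique Δ-clique N₁) (neighbour-new-apex N₁ y₁∈Δ₁ y₁∉Δ)
                (clique-apex (proj₁ (proj₁ N₂)) connected-neighbours-∩⊆ y₂∈Δ₂ (y₂∉Δ ∘ p∩q⊆p Δ Δ₁))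
                (PathAvoiding-antimono (p∩q⊆p Δ Δ₁) y₁⇝y₂)

mainTheorem1 : (k n m : ℕ) → 1 ≤ k → (G : Graph n) → KTree k n G →
               (Δ : Subset n) → IsKClique (suc k) G Δ →
               HasComponents G Δ m →
               (L : List (Subset n)) → Unique L → All (IsNeighbor k G Δ) L →
               length L ≤ m
mainTheorem1 k n m _ G T Δ (Δ-clique , _) (component , same-component⇔path , _) L L-unique L-neighbours =
  injective⇒≤ label-injective
  where
  neighbour : ∀ i → IsNeighbor k G Δ (List.lookup L i)
  neighbour i = All.lookup L-neighbours (∈-lookup i)

  new : ∀ i → ∃ λ y → y ∈ List.lookup L i × y ∉ Δ
  new i = neighbour-new-vertex (neighbour i)

  y : Fin (length L) → Fin n
  y i = proj₁ (new i)

  y∈ : ∀ i → y i ∈ List.lookup L i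
  y∈ i = proj₁ (proj₂ (new i))

  y∉Δ : ∀ i → y i ∉ Δ
  y∉Δ i = proj₂ (proj₂ (new i))

  label : Fin (length L) → Fin m
  label i = component (y i) (y∉Δ i)

  label-injective : Injective _≡_ _≡_ label
  label-injective {i} {j} same-label =
    lookup-injective L-unique i j
      (connected-neighbours-≡ T Δ-clique (neighbour i) (neighbour j) (y∈ i) (y∉Δ i) (y∈ j) (y∉Δ j)
         (to (same-component⇔path _ _ (y∉Δ i) (y∉Δ j)) same-label))
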